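{- Let $G$ be a finite nontrivial group, $r\ge 2$ an integer, and $P,Q$ finite free $G$-posets. Then $\mathcal{C}_{P\times Q}^{(r)}$ is a sub-hypergraph of $\mathcal{C}_P^{(r)}\times \mathcal{C}_Q^{(r)}$ (same vertex set $P\times Q$, and every edge of the former is an edge of the latter). In particular, $\chi (\mathcal{C}_{P\times Q}^{(r)})\leq\chi (\mathcal{C}_P^{(r)}\times \mathcal{C}_Q^{(r)})$.
   Context: A $G$-poset is a poset with an order-preserving $G$-action; it is free if $gp=p$ implies $g=e$. $P\times Q$ is ordered by $(p_1,q_1)\preceq(p_2,q_2)$ iff $p_1\preceq p_2$ and $q_1\preceq q_2$, with diagonal action. For $r\ge2$, $\mathcal C_P^{(r)}$ is the $r$-uniform hypergraph on $P$ whose edges are the $r$-sets of distinct elements $\{p_1,\dots,p_r\}$ such that for all distinct $p_i,p_j$ there is $g\ne e$ with $p_i$ and $g\cdot p_j$ comparable. The categorical product $\mathcal H_1\times\mathcal H_2$ of hypergraphs has vertex set $V(\mathcal H_1)\times V(\mathcal H_2)$ and edges $\{(u_1,v_1),\dots,(u_s,v_s)\}$ ($s\ge1$) with $\{u_1,\dots,u_s\}\in E(\mathcal H_1)$ and $\{v_1,\dots,v_s\}\in E(\mathcal H_2)$. $\chi$ is the hypergraph chromatic number (least number of colors with no monochromatic edge). -}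

module Defs where

open import Level using (0ℓ)
open import Data.Nat using (ℕ; _≤_)
open import Data.Fin using (Fin)
open import Data.Product using (Σ; ∃; _×_; _,_; proj₁; proj₂)
open import Data.Sum using (_⊎_)
open import Data.List using (List; []; length)
open import Data.List.Membership.Propositional using (_∈_)
open import Data.List.Relation.Unary.All using (All)
open import Data.List.Relation.Unary.Unique.Propositional using (Unique)
open import Relation.Nullary using (¬_)
open import Relation.Binary using (Rel; IsPartialOrder)
open import Relation.Binary.PropositionalEquality using (_≡_; _≢_)
open import Algebra.Core using (Op₁; Op₂)
open import Function.Bundles using (_↔_)

Finite : Set → Set
Finite A = Σ ℕ λ n → A ↔ Fin n

record GPoset (G : Set) (_∙_ : Op₂ G) (ε : G) : Set₁ where
  field
    Carrier        : Set
    _≼_            : Rel Carrier 0ℓ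
    isPartialOrder : IsPartialOrder _≡_ _≼_
    act            : G → Carrier → Carrier
    act-id         : ∀ p → act ε p ≡ p
    act-comp       : ∀ g h p → act (g ∙ h) p ≡ act g (act h p)
    act-mono       : ∀ g {p q} → p ≼ q → act g p ≼ act g q

Free : {G : Set} {_∙_ : Op₂ G} {ε : G} → GPoset G _∙_ ε → Set
Free {G} {ε = ε} P = ∀ (g : G) p → GPoset.act P g p ≡ p → g ≡ ε

_×≼_ : {A B : Set} → Rel A 0ℓ → Rel B 0ℓ → Rel (A × B) 0ℓ
(R ×≼ S) x y = R (proj₁ x) (proj₁ y) × S (proj₂ x) (proj₂ y)

diagAct : {G A B : Set} → (G → A → A) → (G → B → B) → G → A × B → A × B
diagAct f h g (a , b) = (f g a , h g b)

-- Hypergraphs on a vertex type V; an edge is a (finite) set of vertices,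
-- represented by a list (edge predicates below require no duplicates).
record Hypergraph (V : Set) : Set₁ where
  field
    Edge : List V → Set
open Hypergraph public

_⊆ₕ_ : {V : Set} → Hypergraph V → Hypergraph V → Set
H₁ ⊆ₕ H₂ = ∀ xs → Edge H₁ xs → Edge H₂ xs

Comparable : {A : Set} → Rel A 0ℓ → A → A → Set
Comparable R p q = R p q ⊎ R q p

C : {G A : Set} → (ε : G) → (r : ℕ) → Rel A 0ℓ → (G → A → A) → Hypergraph A
Edge (C {G} ε r _≼_ act) xs =
  Unique xs × length xs ≡ r ×
  (∀ {p q} → p ∈ xs → q ∈ xs → p ≢ q →
     Σ G λ g → g ≢ ε × Comparable _≼_ p (act g q))

CP : {G : Set} {_∙_ : Op₂ G} {ε : G} → (P : GPoset G _∙_ ε) → ℕ → Hypergraph (GPoset.Carrier P)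
CP {ε = ε} P r = C ε r (GPoset._≼_ P) (GPoset.act P)

CPQ : {G : Set} {_∙_ : Op₂ G} {ε : G} → (P Q : GPoset G _∙_ ε) → ℕ →
      Hypergraph (GPoset.Carrier P × GPoset.Carrier Q)
CPQ {ε = ε} P Q r =
  C ε r (GPoset._≼_ P ×≼ GPoset._≼_ Q) (diagAct (GPoset.act P) (GPoset.act Q))

-- Categorical product of hypergraphs: a nonempty set Z of pairs is an edge
-- iff its set of first coordinates is an edge of H₁ and its set of second
-- coordinates is an edge of H₂.
_×ₕ_ : {U W : Set} → Hypergraph U → Hypergraph W → Hypergraph (U × W)
Edge (_×ₕ_ {U} {W} H₁ H₂) zs =
  Unique zs × zs ≢ [] ×
  (Σ (List U) λ us → Edge H₁ us ×
     (∀ u → (u ∈ us → Σ (U × W) λ z → z ∈ zs × proj₁ z ≡ u) ×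
            ((Σ (U × W) λ z → z ∈ zs × proj₁ z ≡ u) → u ∈ us))) ×
  (Σ (List W) λ ws → Edge H₂ ws ×
     (∀ w → (w ∈ ws → Σ (U × W) λ z → z ∈ zs × proj₂ z ≡ w) ×
            ((Σ (U × W) λ z → z ∈ zs × proj₂ z ≡ w) → w ∈ ws)))

Monochromatic : {V : Set} {k : ℕ} → (V → Fin k) → List V → Set
Monochromatic {k = k} c es = Σ (Fin k) λ col → All (λ v → c v ≡ col) es

Colorable : {V : Set} → Hypergraph V → ℕ → Set
Colorable {V} H k =
  Σ (V → Fin k) λ c → ∀ es → Edge H es → ¬ Monochromatic c es

IsChromaticNumber : {V : Set} → Hypergraph V → ℕ → Set
IsChromaticNumber H n = Colorable H n × (∀ m → Colorable H m → n ≤ m)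

module Submission where

-- Call a G-poset rigid if p and g·p are comparable only for
-- g = e.  Over a finite group every free G-poset is rigid: every g has
-- finite order, g^(k+1) = e, and if p ≼ g·p then iterating gives
-- p ≼ g^k·p, hence g·p ≼ g^(k+1)·p = p, so g·p = p by antisymmetry and
-- g = e by freeness (the case g·p ≼ p is dual).
--
-- Rigidity is exactly what makes a projection of an edge of C_{P×Q} an
-- edge of C_P: a monotone equivariant map π into a rigid G-poset is
-- injective on every edge (π z = π z' would make π z comparable with
-- g·π z for some g ≠ e), so it maps r-sets to r-sets, and it carries the
-- witnesses g of the edge condition along.  Applied to both coordinate
-- projections, this shows that every edge of C_{P×Q} is an edge of the
-- categorical product C_P × C_Q.  Finally, a proper colouring of a
-- hypergraph restricts to any sub-hypergraph, which gives the inequality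
-- of chromatic numbers.

open import Defs
open import Level using (0ℓ)
open import Data.Nat using (ℕ; _≤_; suc; _+_; _∸_)
open import Data.Nat.Properties using (≤-refl; ≤-trans; n≤1+n; m+[n∸m]≡n; +-suc)
open import Data.Fin using (toℕ)
open import Data.Fin.Properties using (pigeonhole)
open import Data.Product using (Σ; _×_; _,_; proj₁; proj₂)
open import Data.Sum using (inj₁; inj₂)
open import Data.List using (List; []; _∷_; map; length)
open import Data.List.Properties using (length-map)
open import Data.List.Membership.Propositional using (_∈_)
open import Data.List.Membership.Propositional.Properties using (∈-map⁺; ∈-map⁻)
import Data.List.Relation.Unary.All as All
import Data.List.Relation.Unary.All.Properties as All
open import Data.List.Relation.Unary.Any using (here; there)
open import Data.List.Relation.Unary.AllPairs using ([]; _∷_)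
open import Data.List.Relation.Unary.Unique.Propositional using (Unique)
open import Relation.Binary using (Rel; IsPartialOrder)
open import Relation.Binary.PropositionalEquality
  using (_≡_; _≢_; refl; sym; trans; cong; subst; module ≡-Reasoning)
open import Algebra.Core using (Op₁; Op₂)
open import Algebra.Structures using (IsGroup)
open import Algebra.Bundles using (Group)
import Algebra.Properties.Group as GroupProperties
import Algebra.Properties.Monoid.Mult as MonoidMult
open import Function.Bundles using (Inverse)

-- By pigeonhole two of the powers g^0,…,g^n
-- coincide, g^i = g^(i+k+1), and cancelling g^i leaves g^(k+1) = e.
module FiniteOrder {G : Set} {_∙_ : Op₂ G} {ε : G} {_⁻¹ : Op₁ G}
                   (isGroup : IsGroup _≡_ _∙_ ε _⁻¹) where

  group : Group 0ℓ 0ℓ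
  group = record { isGroup = isGroup }

  open MonoidMult (Group.monoid group) public
    using () renaming (_×_ to power; ×-homo-+ to power-homo-+)

  finite-order : Finite G → ∀ g → Σ ℕ λ k → power (suc k) g ≡ ε
  finite-order (n , G↔Fin) g
    with i , j , i<j , same-code ←
           pigeonhole (≤-refl {suc n}) (λ m → Inverse.to G↔Fin (power (toℕ m) g))
    = k , GroupProperties.identityʳ-unique group (power (toℕ i) g) _ gⁱ∙gᵏ⁺¹≡gⁱ
    where
    open Inverse G↔Fin

    k : ℕ
    k = toℕ j ∸ suc (toℕ i)

    gⁱ∙gᵏ⁺¹≡gⁱ : power (toℕ i) g ∙ power (suc k) g ≡ power (toℕ i) g
    gⁱ∙gᵏ⁺¹≡gⁱ = begin
      power (toℕ i) g ∙ power (suc k) g ≡⟨ power-homo-+ g (toℕ i) (suc k) ⟨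
      power (toℕ i + suc k) g           ≡⟨ cong (λ m → power m g) (trans (+-suc (toℕ i) k) (m+[n∸m]≡n i<j)) ⟩
      power (toℕ j) g                   ≡⟨ strictlyInverseʳ _ ⟨
      from (to (power (toℕ j) g))       ≡⟨ cong from same-code ⟨
      from (to (power (toℕ i) g))       ≡⟨ strictlyInverseʳ _ ⟩
      power (toℕ i) g                   ∎
      where open ≡-Reasoning

Rigid : {G A : Set} → G → Rel A 0ℓ → (G → A → A) → Set
Rigid {G} {A} ε _≼_ act = ∀ (g : G) (p : A) → Comparable _≼_ p (act g p) → g ≡ ε

module _ {G : Set} {_∙_ : Op₂ G} {ε : G} {_⁻¹ : Op₁ G}
         (isGroup : IsGroup _≡_ _∙_ ε _⁻¹) (P : GPoset G _∙_ ε) where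
  open FiniteOrder isGroup
  open GPoset P
  open IsPartialOrder isPartialOrder using (antisym)
    renaming (reflexive to ≼-reflexive; trans to ≼-trans)

  below-powers : ∀ g p → p ≼ act g p → ∀ k → p ≼ act (power k g) p
  below-powers g p p≼gp 0       = ≼-reflexive (sym (act-id p))
  below-powers g p p≼gp (suc k) =
    ≼-trans p≼gp (subst (act g p ≼_) (sym (act-comp g (power k g) p))
                        (act-mono g (below-powers g p p≼gp k)))

  above-powers : ∀ g p → act g p ≼ p → ∀ k → act (power k g) p ≼ p
  above-powers g p gp≼p 0       = ≼-reflexive (act-id p)
  above-powers g p gp≼p (suc k) =
    ≼-trans (subst (_≼ act g p) (sym (act-comp g (power k g) p))
                   (act-mono g (above-powers g p gp≼p k)))
            gp≼p

  g·gᵏp≡p : ∀ g k → power (suc k) g ≡ ε → ∀ p → act g (act (power k g) p) ≡ p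
  g·gᵏp≡p g k gᵏ⁺¹≡ε p = begin
    act g (act (power k g) p) ≡⟨ act-comp g (power k g) p ⟨
    act (power (suc k) g) p   ≡⟨ cong (λ h → act h p) gᵏ⁺¹≡ε ⟩
    act ε p                   ≡⟨ act-id p ⟩
    p                         ∎
    where open ≡-Reasoning

  -- An element g of finite order can move p only to a point incomparable
  -- with p: comparability forces both g·p ≼ p and p ≼ g·p.
  comparable-translate-is-fixed : ∀ g k → power (suc k) g ≡ ε →
    ∀ p → Comparable _≼_ p (act g p) → act g p ≡ p
  comparable-translate-is-fixed g k gᵏ⁺¹≡ε p (inj₁ p≼gp) =
    antisym (subst (act g p ≼_) (g·gᵏp≡p g k gᵏ⁺¹≡ε p) (act-mono g (below-powers g p p≼gp k)))
            p≼gp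
  comparable-translate-is-fixed g k gᵏ⁺¹≡ε p (inj₂ gp≼p) =
    antisym gp≼p
            (subst (_≼ act g p) (g·gᵏp≡p g k gᵏ⁺¹≡ε p) (act-mono g (above-powers g p gp≼p k)))

  free⇒rigid : Finite G → Free P → Rigid ε _≼_ act
  free⇒rigid finite free g p comparable
    with k , gᵏ⁺¹≡ε ← finite-order finite g
    = free g p (comparable-translate-is-fixed g k gᵏ⁺¹≡ε p comparable)

map-unique : {A B : Set} (f : A → B) (xs : List A) → Unique xs →
  (∀ {x y} → x ∈ xs → y ∈ xs → x ≢ y → f x ≢ f y) → Unique (map f xs)
map-unique f []       []             _   = []
map-unique f (x ∷ xs) (x∉xs ∷ uniq) inj =
  All.map⁺ (All.tabulate λ y∈xs → inj (here refl) (there y∈xs) (All.lookup x∉xs y∈xs))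
  ∷ map-unique f xs uniq (λ x∈ y∈ → inj (there x∈) (there y∈))

map-image : {A B : Set} (f : A → B) (xs : List A) (y : B) →
  (y ∈ map f xs → Σ A λ x → x ∈ xs × f x ≡ y) ×
  ((Σ A λ x → x ∈ xs × f x ≡ y) → y ∈ map f xs)
map-image f xs y =
  (λ y∈ → let x , x∈ , y≡fx = ∈-map⁻ f y∈ in x , x∈ , sym y≡fx) ,
  (λ { (x , x∈ , refl) → ∈-map⁺ f x∈ })

edge-nonempty : {A : Set} (r : ℕ) (xs : List A) → 1 ≤ r → length xs ≡ r → xs ≢ []
edge-nonempty (suc r) xs _ |xs|≡r refl with () ← |xs|≡r

-- A monotone equivariant map π into a rigid G-ordered set sends edges of
-- C^{(r)} to edges of C^{(r)}: π is injective on an edge (by rigidity),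
-- and each witness g for a pair z, z' is a witness for π z, π z'.
module EquivariantImage {G A B : Set} (ε : G)
    (_≼A_ : Rel A 0ℓ) (actA : G → A → A) (_≼B_ : Rel B 0ℓ) (actB : G → B → B)
    (π : A → B)
    (monotone : ∀ {x y} → x ≼A y → π x ≼B π y)
    (equivariant : ∀ g x → π (actA g x) ≡ actB g (π x))
    (rigid : Rigid ε _≼B_ actB) where

  comparable-image : ∀ g {x y} → Comparable _≼A_ x (actA g y) →
    Comparable _≼B_ (π x) (actB g (π y))
  comparable-image g {x} {y} (inj₁ x≼gy) =
    inj₁ (subst (π x ≼B_) (equivariant g y) (monotone x≼gy))
  comparable-image g {x} {y} (inj₂ gy≼x) =
    inj₂ (subst (_≼B π x) (equivariant g y) (monotone gy≼x))

  image-edge : ∀ r xs → Edge (C ε r _≼A_ actA) xs → Edge (C ε r _≼B_ actB) (map π xs)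
  image-edge r xs (unique , |xs|≡r , witnesses) =
    map-unique π xs unique injective-on-edge ,
    trans (length-map π xs) |xs|≡r ,
    image-witnesses
    where
    injective-on-edge : ∀ {x y} → x ∈ xs → y ∈ xs → x ≢ y → π x ≢ π y
    injective-on-edge {x} {y} x∈ y∈ x≢y πx≡πy
      with g , g≢ε , comparable ← witnesses x∈ y∈ x≢y
      = g≢ε (rigid g (π y)
          (subst (λ b → Comparable _≼B_ b (actB g (π y))) πx≡πy (comparable-image g comparable)))

    image-witnesses : ∀ {p q} → p ∈ map π xs → q ∈ map π xs → p ≢ q →
      Σ G λ g → g ≢ ε × Comparable _≼B_ p (actB g q)
    image-witnesses p∈ q∈ p≢q
      with x , x∈ , refl ← ∈-map⁻ π p∈
      with y , y∈ , refl ← ∈-map⁻ π q∈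
      with g , g≢ε , comparable ← witnesses x∈ y∈ (λ x≡y → p≢q (cong π x≡y))
      = g , g≢ε , comparable-image g comparable

product-edges : {G A B : Set} (ε : G) (r : ℕ) → 1 ≤ r →
  (_≼A_ : Rel A 0ℓ) (actA : G → A → A) (_≼B_ : Rel B 0ℓ) (actB : G → B → B) →
  Rigid ε _≼A_ actA → Rigid ε _≼B_ actB →
  C ε r (_≼A_ ×≼ _≼B_) (diagAct actA actB) ⊆ₕ (C ε r _≼A_ actA ×ₕ C ε r _≼B_ actB)
product-edges ε r r≥1 _≼A_ actA _≼B_ actB rigidA rigidB zs edge@(unique , |zs|≡r , _) =
  unique ,
  edge-nonempty r zs r≥1 |zs|≡r ,
  (map proj₁ zs , First.image-edge r zs edge , map-image proj₁ zs) ,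
  (map proj₂ zs , Second.image-edge r zs edge , map-image proj₂ zs)
  where
  module First  = EquivariantImage ε (_≼A_ ×≼ _≼B_) (diagAct actA actB) _≼A_ actA
                    proj₁ proj₁ (λ _ _ → refl) rigidA
  module Second = EquivariantImage ε (_≼A_ ×≼ _≼B_) (diagAct actA actB) _≼B_ actB
                    proj₂ proj₂ (λ _ _ → refl) rigidB

colorable-sub : {V : Set} {H₁ H₂ : Hypergraph V} {k : ℕ} →
  H₁ ⊆ₕ H₂ → Colorable H₂ k → Colorable H₁ k
colorable-sub H₁⊆H₂ (c , proper) = c , λ es e → proper es (H₁⊆H₂ es e)

chromatic-mono : {V : Set} {H₁ H₂ : Hypergraph V} → H₁ ⊆ₕ H₂ →
  ∀ a b → IsChromaticNumber H₁ a → IsChromaticNumber H₂ b → a ≤ b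
chromatic-mono H₁⊆H₂ a b (_ , least) (colorable , _) =
  least b (colorable-sub H₁⊆H₂ colorable)

lemma5p8 : (G : Set) (_∙_ : Op₂ G) (ε : G) (_⁻¹ : Op₁ G) →
           IsGroup _≡_ _∙_ ε _⁻¹ → Finite G → Σ G (λ g → g ≢ ε) →
           (r : ℕ) → 2 ≤ r →
           (P Q : GPoset G _∙_ ε) →
           Finite (GPoset.Carrier P) → Finite (GPoset.Carrier Q) →
           Free P → Free Q →
           (CPQ P Q r ⊆ₕ (CP P r ×ₕ CP Q r)) ×
           (∀ a b → IsChromaticNumber (CPQ P Q r) a →
                    IsChromaticNumber (CP P r ×ₕ CP Q r) b → a ≤ b)
lemma5p8 G _∙_ ε _⁻¹ isGroup finiteG _ r r≥2 P Q _ _ freeP freeQ =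
  sub , chromatic-mono sub
  where
  sub : CPQ P Q r ⊆ₕ (CP P r ×ₕ CP Q r)
  sub = product-edges ε r (≤-trans (n≤1+n 1) r≥2)
          (GPoset._≼_ P) (GPoset.act P) (GPoset._≼_ Q) (GPoset.act Q)
          (free⇒rigid isGroup P finiteG freeP)
          (free⇒rigid isGroup Q finiteG freeQ)
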